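{- For every integer $h\ge1$, let $t_{n,m,h}$ be the number of active growing binary trees of height $h$ with $n$ internal nodes and $m$ anchors, let $S_h=\{(n,k)\in\mathbb{Z}_{>0}^2 : t_{n,2k,h}\neq0\}$, and let $\Lambda_h=\{(n,k)\in S_h : t_{n,2(k+1),h}=0\}$. Then \[ \Lambda_h=\{(h,\hat a_1),(h+1,\hat a_2),\ldots,(2^h-1,\hat a_{2^h-h})\}=\{(n,\hat a_{n-h+1}) : h\le n\le 2^h-1\}, \] where $\hat a_n=\min\{k\ge1 : \sum_{i=1}^{k}\hat b_i\ge n\}$ and $\hat b_n$ is the ruler function, i.e. the number of times $2n$ can be divided by $2$.
   Context: Growing binary trees are plane (ordered) binary trees whose nodes are of three types: internal nodes, anchors (active leaves) and dead leaves. They are produced by the following growth process: at time $t=0$ the tree consists of a single anchor; at each time $t=1,2,\dots$, every anchor is simultaneously replaced either by a dead leaf or by an internal node with two anchors as children. A growing binary tree is any tree obtainable after finitely many steps of this process; it is active if it has at least one anchor. The height of a tree is the maximal distance from the root to a node. The sequence $(\hat a_n)_{n\ge1}$ is the nondecreasing sequence $1,2,2,3,4,4,4,5,6,6,7,8,\dots$ in which each $k\ge1$ appears exactly $\hat b_k$ times. -}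

module Defs where

open import Data.Nat using (ℕ; zero; suc; _+_; _*_; _∸_; _^_; _≤_; _⊔_; ⌊_/2⌋; _%_; _≡ᵇ_)
open import Data.Bool using (if_then_else_)
open import Data.Product using (Σ; ∃; _×_)
open import Relation.Binary.PropositionalEquality using (_≡_)
open import Relation.Nullary using (¬_)

data Tree : Set where
  anchor : Tree
  dead   : Tree
  node   : Tree → Tree → Tree

data Step : Tree → Tree → Set where
  anchor→dead : Step anchor dead
  anchor→node : Step anchor (node anchor anchor)
  dead→dead   : Step dead dead
  node→node   : ∀ {l l′ r r′} → Step l l′ → Step r r′ → Step (node l r) (node l′ r′)

data Reach : ℕ → Tree → Set where
  start : Reach zero anchor
  grow  : ∀ {t T T′} → Reach t T → Step T T′ → Reach (suc t) T′

GrowingTree : Tree → Set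
GrowingTree T = ∃ λ t → Reach t T

anchors : Tree → ℕ
anchors anchor     = 1
anchors dead       = 0
anchors (node l r) = anchors l + anchors r

internals : Tree → ℕ
internals anchor     = 0
internals dead       = 0
internals (node l r) = suc (internals l + internals r)

height : Tree → ℕ
height anchor     = 0
height dead       = 0
height (node l r) = suc (height l ⊔ height r)

Active : Tree → Set
Active T = 1 ≤ anchors T

TNonZero : ℕ → ℕ → ℕ → Set
TNonZero n m h =
  Σ Tree λ T → GrowingTree T × Active T × height T ≡ h × internals T ≡ n × anchors T ≡ m

InΛ : ℕ → ℕ → ℕ → Set
InΛ h n k = (1 ≤ n × 1 ≤ k) × TNonZero n (2 * k) h × ¬ TNonZero n (2 * suc k) h

-- number of times m can be divided by 2 (fuel-bounded; fuel m suffices)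
val2 : ℕ → ℕ → ℕ
val2 zero    m       = 0
val2 (suc f) zero    = 0
val2 (suc f) (suc m) =
  if (suc m % 2) ≡ᵇ 0 then suc (val2 f ⌊ suc m /2⌋) else 0

bHat : ℕ → ℕ
bHat n = val2 (2 * n) (2 * n)

sumB : ℕ → ℕ
sumB zero    = 0
sumB (suc k) = sumB k + bHat (suc k)

IsAHat : ℕ → ℕ → Set
IsAHat m k = (1 ≤ k × m ≤ sumB k) × (∀ j → 1 ≤ j → m ≤ sumB j → k ≤ j)

{-# OPTIONS --safe #-}
-- A tree reached after t steps has all its anchors at depth t, so the active growing trees of
-- height h are the active trees reached after exactly h steps. A step expanding c anchors adds
-- c internal nodes and leaves 2c anchors. By induction, a tree reached after t+1 steps with 2k
-- anchors and i internal nodes exists iff k ≤ 2^t and k + ⌈k/2⌉ + ⌈k/4⌉ + ⋯ (t+1 terms) ≤ i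
-- < 2^t + k. As B(k) = b̂₁ + ⋯ + b̂_k satisfies B(k) = k + B(⌊k/2⌋), the lower bound is
-- h + B(k−1) with h = t+1. Hence 2(k+1) anchors are impossible while 2k are possible exactly
-- when h + B(k−1) ≤ n < h + B(k), i.e. k = â_{n−h+1}, and n stays below 2^h = 1 + B(2^t).
module Submission where

open import Data.Bool using (if_then_else_)
open import Data.Nat
  using (ℕ; zero; suc; pred; NonZero; _+_; _*_; _∸_; _^_; _≤_; _<_; _≤′_; ≤′-reflexive; ≤′-step;
         _≡ᵇ_; _%_; ⌊_/2⌋; ⌈_/2⌉; z≤n; s≤s; s≤s⁻¹; _<?_)
open import Data.Nat.DivMod using (m*n%n≡0; [m+kn]%n≡m%n)
open import Data.Nat.Properties
open import Algebra.Properties.CommutativeSemigroup +-commutativeSemigroup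
  using (interchange; x∙yz≈y∙xz)
open import Data.Product using (∃-syntax; _×_; _,_)
open import Data.Sum using (_⊎_; inj₁; inj₂)
open import Function.Base using (_∘_)
open import Function.Bundles using (_⇔_; mk⇔; Equivalence)
open import Function.Properties.Equivalence using () renaming (trans to ⇔-trans)
open import Relation.Binary.PropositionalEquality
open import Relation.Nullary using (¬_; yes; no)

open import Defs

record Expands (c : ℕ) (T T′ : Tree) : Set where
  constructor expands
  field
    anchors-expanded   : anchors T′ ≡ 2 * c
    internals-expanded : internals T′ ≡ internals T + c

expands-node : ∀ {c₁ c₂ l l′ r r′} → Expands c₁ l l′ → Expands c₂ r r′ →
               Expands (c₁ + c₂) (node l r) (node l′ r′)
expands-node {c₁} {c₂} {l} {_} {r} (expands al il) (expands ar ir) = expands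
  (trans (cong₂ _+_ al ar) (sym (*-distribˡ-+ 2 c₁ c₂)))
  (cong suc (trans (cong₂ _+_ il ir) (interchange (internals l) c₁ (internals r) c₂)))

step⇒expands : ∀ {T T′} → Step T T′ → ∃[ c ] c ≤ anchors T × Expands c T T′
step⇒expands anchor→dead       = 0 , z≤n , expands refl refl
step⇒expands anchor→node       = 1 , ≤-refl , expands refl refl
step⇒expands dead→dead         = 0 , z≤n , expands refl refl
step⇒expands (node→node sl sr) with step⇒expands sl | step⇒expands sr
... | c₁ , c₁≤ , e₁ | c₂ , c₂≤ , e₂ = c₁ + c₂ , +-mono-≤ c₁≤ c₂≤ , expands-node e₁ e₂

-- The left subtree expands as many of the c anchors as it can, the right one the rest.
expand : ∀ T {c} → c ≤ anchors T → ∃[ T′ ] Step T T′ × Expands c T T′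
expand anchor {zero}        _        = dead , anchor→dead , expands refl refl
expand anchor {suc zero}    _        = node anchor anchor , anchor→node , expands refl refl
expand anchor {suc (suc _)} (s≤s ())
expand dead   {zero}        _        = dead , dead→dead , expands refl refl
expand dead   {suc _}       ()
expand (node l r) {c} c≤ with expand l (m⊓n≤m (anchors l) c)
                            | expand r (m≤n+o⇒m∸n≤o c (anchors l) c≤)
... | l′ , sl , el | r′ , sr , er =
  node l′ r′ , node→node sl sr ,
  subst (λ x → Expands x (node l r) (node l′ r′)) (m⊓n+n∸m≡n (anchors l) c) (expands-node el er)

data Layered : ℕ → Tree → Set where
  anchor : Layered 0 anchor
  dead   : ∀ {t} → Layered (suc t) dead
  node   : ∀ {t l r} → Layered t l → Layered t r → Layered (suc t) (node l r)

step-layered : ∀ {t T T′} → Layered t T → Step T T′ → Layered (suc t) T′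
step-layered anchor       anchor→dead       = dead
step-layered anchor       anchor→node       = node anchor anchor
step-layered dead         dead→dead         = dead
step-layered (node Ll Lr) (node→node sl sr) = node (step-layered Ll sl) (step-layered Lr sr)

reach⇒layered : ∀ {t T} → Reach t T → Layered t T
reach⇒layered start      = anchor
reach⇒layered (grow r s) = step-layered (reach⇒layered r) s

layered⇒height≤ : ∀ {t T} → Layered t T → height T ≤ t
layered⇒height≤ anchor       = z≤n
layered⇒height≤ dead         = z≤n
layered⇒height≤ (node Ll Lr) = s≤s (⊔-lub (layered⇒height≤ Ll) (layered⇒height≤ Lr))

active-node : ∀ l r → Active (node l r) → Active l ⊎ Active r
active-node l r act with anchors l
... | zero  = inj₂ act
... | suc _ = inj₁ (s≤s z≤n)

layered-active⇒height≥ : ∀ {t T} → Layered t T → Active T → t ≤ height T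
layered-active⇒height≥ anchor _ = z≤n
layered-active⇒height≥ {T = node l r} (node Ll Lr) act with active-node l r act
... | inj₁ al = s≤s (≤-trans (layered-active⇒height≥ Ll al) (m≤m⊔n (height l) (height r)))
... | inj₂ ar = s≤s (≤-trans (layered-active⇒height≥ Lr ar) (m≤n⊔m (height l) (height r)))

height-reach : ∀ {t T} → Reach t T → Active T → height T ≡ t
height-reach {t} {T} r act = ≤-antisym (layered⇒height≤ L) (layered-active⇒height≥ L act)
  where
  L : Layered t T
  L = reach⇒layered r

2*n≡n+n : ∀ n → 2 * n ≡ n + n
2*n≡n+n n = cong (n +_) (+-identityʳ n)

⌊2*n/2⌋≡n : ∀ n → ⌊ 2 * n /2⌋ ≡ n
⌊2*n/2⌋≡n n = sym (trans (n≡⌊n+n/2⌋ n) (cong ⌊_/2⌋ (sym (2*n≡n+n n))))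

⌈2*n/2⌉≡n : ∀ n → ⌈ 2 * n /2⌉ ≡ n
⌈2*n/2⌉≡n n = sym (trans (n≡⌈n+n/2⌉ n) (cong ⌈_/2⌉ (sym (2*n≡n+n n))))

n≤2*m⇒⌈n/2⌉≤m : ∀ {m n} → n ≤ 2 * m → ⌈ n /2⌉ ≤ m
n≤2*m⇒⌈n/2⌉≤m {m} n≤2m = ≤-trans (⌈n/2⌉-mono n≤2m) (≤-reflexive (⌈2*n/2⌉≡n m))

⌈n/2⌉≤m⇒n≤2*m : ∀ {m n} → ⌈ n /2⌉ ≤ m → n ≤ 2 * m
⌈n/2⌉≤m⇒n≤2*m {m} {n} ⌈n/2⌉≤m = begin
  n                   ≡⟨ sym (⌊n/2⌋+⌈n/2⌉≡n n) ⟩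
  ⌊ n /2⌋ + ⌈ n /2⌉   ≤⟨ +-mono-≤ (≤-trans (⌊n/2⌋≤⌈n/2⌉ n) ⌈n/2⌉≤m) ⌈n/2⌉≤m ⟩
  m + m               ≡⟨ sym (2*n≡n+n m) ⟩
  2 * m               ∎
  where open ≤-Reasoning

val2-fuel : ∀ {f f′ m} → m ≤ f → m ≤ f′ → val2 f m ≡ val2 f′ m
val2-fuel {zero}  {zero}  z≤n _ = refl
val2-fuel {zero}  {suc _} z≤n _ = refl
val2-fuel {suc _} {zero}  z≤n _ = refl
val2-fuel {suc _} {suc _} z≤n _ = refl
val2-fuel {suc f} {suc f′} {suc m} (s≤s m≤f) (s≤s m≤f′) =
  cong (λ v → if (suc m % 2) ≡ᵇ 0 then suc v else 0)
       (val2-fuel (≤-trans half≤m m≤f) (≤-trans half≤m m≤f′))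
  where
  half≤m : ⌊ suc m /2⌋ ≤ m
  half≤m = s≤s⁻¹ (⌊n/2⌋<n m)

-- With fuel m the recursion of val2 never runs dry, so ν₂ is the 2-adic valuation,
-- and bHat n unfolds to ν₂ (2 * n).
ν₂ : ℕ → ℕ
ν₂ m = val2 m m

ν₂-odd : ∀ m → ν₂ (suc (2 * m)) ≡ 0
ν₂-odd m = cong (λ r → if r ≡ᵇ 0 then suc (val2 (2 * m) ⌈ 2 * m /2⌉) else 0)
                (trans (cong (λ x → suc x % 2) (*-comm 2 m)) ([m+kn]%n≡m%n 1 m 2))

ν₂-double : ∀ n .{{_ : NonZero n}} → ν₂ (2 * n) ≡ suc (ν₂ n)
ν₂-double (suc m) = begin
  ν₂ (2 * suc m)                ≡⟨ cong (λ r → if r ≡ᵇ 0 then suc (val2 f ⌊ 2 * suc m /2⌋) else 0) even ⟩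
  suc (val2 f ⌊ 2 * suc m /2⌋)  ≡⟨ cong (suc ∘ val2 f) (⌊2*n/2⌋≡n (suc m)) ⟩
  suc (val2 f (suc m))          ≡⟨ cong suc (val2-fuel (s≤s⁻¹ (m<m+n (suc m) (s≤s z≤n))) ≤-refl) ⟩
  suc (ν₂ (suc m))              ∎
  where
  open ≡-Reasoning
  f : ℕ
  f = pred (2 * suc m)
  even : (2 * suc m) % 2 ≡ 0
  even = trans (cong (_% 2) (*-comm 2 (suc m))) (m*n%n≡0 (suc m) 2)

bHat-odd : ∀ j → bHat (suc (2 * j)) ≡ 1
bHat-odd j = trans (ν₂-double (suc (2 * j))) (cong suc (ν₂-odd j))

bHat-even : ∀ j → bHat (2 * suc j) ≡ suc (bHat (suc j))
bHat-even j = ν₂-double (2 * suc j)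

data Parity : ℕ → Set where
  even : ∀ j → Parity (2 * j)
  odd  : ∀ j → Parity (suc (2 * j))

parity : ∀ n → Parity n
parity zero = even 0
parity (suc n) with parity n
... | even j = odd j
... | odd j  = subst Parity (*-suc 2 j) (even (suc j))

bHat-suc : ∀ n → sumB ⌊ n /2⌋ + bHat (suc n) ≡ suc (sumB ⌊ suc n /2⌋)
bHat-suc n with parity n
... | even j = begin
  sumB ⌊ 2 * j /2⌋ + bHat (suc (2 * j))  ≡⟨ cong₂ _+_ (cong sumB (⌊2*n/2⌋≡n j)) (bHat-odd j) ⟩
  sumB j + 1                            ≡⟨ +-comm (sumB j) 1 ⟩
  suc (sumB j)                          ≡⟨ cong (suc ∘ sumB) (sym (⌈2*n/2⌉≡n j)) ⟩
  suc (sumB ⌈ 2 * j /2⌉)                ∎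
  where open ≡-Reasoning
... | odd j = begin
  sumB ⌈ 2 * j /2⌉ + bHat (suc (suc (2 * j)))
    ≡⟨ cong₂ _+_ (cong sumB (⌈2*n/2⌉≡n j)) (trans (cong bHat (sym (*-suc 2 j))) (bHat-even j)) ⟩
  sumB j + suc (bHat (suc j))                  ≡⟨ +-suc (sumB j) (bHat (suc j)) ⟩
  suc (sumB (suc j))                           ≡⟨ cong (suc ∘ sumB ∘ suc) (sym (⌊2*n/2⌋≡n j)) ⟩
  suc (sumB (suc ⌊ 2 * j /2⌋))                 ∎
  where open ≡-Reasoning

sumB-half : ∀ n → sumB n ≡ n + sumB ⌊ n /2⌋
sumB-half zero    = refl
sumB-half (suc n) = begin
  sumB n + bHat (suc n)                    ≡⟨ cong (_+ bHat (suc n)) (sumB-half n) ⟩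
  n + sumB ⌊ n /2⌋ + bHat (suc n)          ≡⟨ +-assoc n _ _ ⟩
  n + (sumB ⌊ n /2⌋ + bHat (suc n))        ≡⟨ cong (n +_) (bHat-suc n) ⟩
  n + suc (sumB ⌊ suc n /2⌋)               ≡⟨ +-suc n _ ⟩
  suc n + sumB ⌊ suc n /2⌋                 ∎
  where open ≡-Reasoning

sumB-2^ : ∀ t → suc (sumB (2 ^ t)) ≡ 2 ^ suc t
sumB-2^ zero    = refl
sumB-2^ (suc t) = begin
  suc (sumB (2 * N))               ≡⟨ cong suc (sumB-half (2 * N)) ⟩
  suc (2 * N + sumB ⌊ 2 * N /2⌋)   ≡⟨ cong (λ x → suc (2 * N + sumB x)) (⌊2*n/2⌋≡n N) ⟩
  suc (2 * N + sumB N)             ≡⟨ sym (+-suc (2 * N) (sumB N)) ⟩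
  2 * N + suc (sumB N)             ≡⟨ cong (2 * N +_) (sumB-2^ t) ⟩
  2 * N + 2 * N                    ≡⟨ sym (2*n≡n+n (2 * N)) ⟩
  2 * (2 * N)                      ∎
  where
  open ≡-Reasoning
  N : ℕ
  N = 2 ^ t

sumB-mono : ∀ {m n} → m ≤ n → sumB m ≤ sumB n
sumB-mono = mono′ ∘ ≤⇒≤′
  where
  mono′ : ∀ {m n} → m ≤′ n → sumB m ≤ sumB n
  mono′ (≤′-reflexive refl) = ≤-refl
  mono′ (≤′-step m≤′n)      = ≤-trans (mono′ m≤′n) (m≤m+n _ _)

isAHat⇔ : ∀ {d k} → IsAHat (suc d) (suc k) ⇔ (sumB k ≤ d × suc d ≤ sumB (suc k))
isAHat⇔ {d} {k} = mk⇔ (λ ((_ , d<B) , minimal) → below k minimal , d<B)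
                      (λ (B≤d , d<B) → (s≤s z≤n , d<B) , least B≤d)
  where
  below : ∀ k → (∀ j → 1 ≤ j → suc d ≤ sumB j → suc k ≤ j) → sumB k ≤ d
  below zero    _       = z≤n
  below (suc k) minimal = ≮⇒≥ λ d<B → <-irrefl refl (minimal (suc k) (s≤s z≤n) d<B)
  least : sumB k ≤ d → ∀ j → 1 ≤ j → suc d ≤ sumB j → suc k ≤ j
  least B≤d j _ d<B = ≮⇒≥ λ j<1+k → ≤⇒≯ (≤-trans (sumB-mono (s≤s⁻¹ j<1+k)) B≤d) d<B

-- Expanding k anchors needs at least ⌈ k /2⌉ of their parents to be expanded one step earlier.
minInternals : ℕ → ℕ → ℕ
minInternals zero    k = k
minInternals (suc t) k = k + minInternals t ⌈ k /2⌉

-- The possible counts of i internal nodes and 2 * k anchors after suc t steps.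
record Feasible (t i k : ℕ) : Set where
  constructor feasible
  field
    bounded : k ≤ 2 ^ t
    lower   : minInternals t k ≤ i
    upper   : i < 2 ^ t + k

minInternals-mono : ∀ t {a b} → a ≤ b → minInternals t a ≤ minInternals t b
minInternals-mono zero    a≤b = a≤b
minInternals-mono (suc t) a≤b = +-mono-≤ a≤b (minInternals-mono t (⌈n/2⌉-mono a≤b))

k≤minInternals : ∀ t k → k ≤ minInternals t k
k≤minInternals zero    k = ≤-refl
k≤minInternals (suc t) k = m≤m+n k _

minInternals< : ∀ t {k} → k ≤ 2 ^ t → minInternals t k < 2 ^ t + k
minInternals< zero    _   = ≤-refl
minInternals< (suc t) {k} k≤2N = begin-strict
  k + minInternals t ⌈ k /2⌉   <⟨ +-monoʳ-< k (minInternals< t half≤N) ⟩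
  k + (N + ⌈ k /2⌉)            ≤⟨ +-monoʳ-≤ k (+-monoʳ-≤ N half≤N) ⟩
  k + (N + N)                  ≡⟨ cong (k +_) (sym (2*n≡n+n N)) ⟩
  k + 2 * N                    ≡⟨ +-comm k (2 * N) ⟩
  2 * N + k                    ∎
  where
  open ≤-Reasoning
  N : ℕ
  N = 2 ^ t
  half≤N : ⌈ k /2⌉ ≤ N
  half≤N = n≤2*m⇒⌈n/2⌉≤m k≤2N

minInternals-suc : ∀ t {k} → suc k ≤ 2 ^ t → minInternals t (suc k) ≡ suc t + sumB k
minInternals-suc zero    {zero}  _        = refl
minInternals-suc zero    {suc _} (s≤s ())
minInternals-suc (suc t) {k}     1+k≤2N   = begin
  suc k + minInternals t (suc ⌊ k /2⌋)
    ≡⟨ cong (suc k +_) (minInternals-suc t (n≤2*m⇒⌈n/2⌉≤m 1+k≤2N)) ⟩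
  suc k + (suc t + sumB ⌊ k /2⌋)         ≡⟨ x∙yz≈y∙xz (suc k) (suc t) _ ⟩
  suc t + (suc k + sumB ⌊ k /2⌋)         ≡⟨ +-suc (suc t) _ ⟩
  suc (suc t) + (k + sumB ⌊ k /2⌋)       ≡⟨ cong (suc (suc t) +_) (sym (sumB-half k)) ⟩
  suc (suc t) + sumB k                   ∎
  where open ≡-Reasoning

feasible-expand : ∀ {t i k c} → Feasible t i k → c ≤ 2 * k → Feasible (suc t) (i + c) c
feasible-expand {t} {i} {k} {c} (feasible k≤N lower upper) c≤2k = feasible
  (≤-trans c≤2k (*-monoʳ-≤ 2 k≤N))
  (subst (minInternals (suc t) c ≤_) (+-comm c i)
         (+-monoʳ-≤ c (≤-trans (minInternals-mono t (n≤2*m⇒⌈n/2⌉≤m c≤2k)) lower)))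
  (+-monoˡ-< c (<-≤-trans upper (subst (N + k ≤_) (sym (2*n≡n+n N)) (+-monoʳ-≤ N k≤N))))
  where
  N : ℕ
  N = 2 ^ t

reach⇒feasible : ∀ {t T} → Reach (suc t) T → ∃[ k ] anchors T ≡ 2 * k × Feasible t (internals T) k
reach⇒feasible {zero}  (grow start anchor→dead) = 0 , refl , feasible z≤n z≤n (s≤s z≤n)
reach⇒feasible {zero}  (grow start anchor→node) = 1 , refl , feasible ≤-refl ≤-refl ≤-refl
reach⇒feasible {suc t} (grow r s) with reach⇒feasible r | step⇒expands s
... | k , aP , f | c , c≤aP , expands aT iT =
  c , aT , subst (λ i → Feasible (suc t) i c) (sym iT) (feasible-expand f (subst (c ≤_) aP c≤aP))

-- The parent has 2 * ⌈ c /2⌉ anchors unless i ∸ c would then exceed its maximal number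
-- 2 ^ t + k - 1 of internal nodes; in that case k is raised until i ∸ c is that maximum.
feasible-parent : ∀ {t i c} → Feasible (suc t) i c → ∃[ k ] c ≤ 2 * k × Feasible t (i ∸ c) k
feasible-parent {t} {i} {c} (feasible c≤2N lower upper) with i ∸ c <? 2 ^ t + ⌈ c /2⌉
... | yes i′<N+half =
  ⌈ c /2⌉ , ⌈n/2⌉≤m⇒n≤2*m ≤-refl , feasible (n≤2*m⇒⌈n/2⌉≤m c≤2N) lower′ i′<N+half
  where
  N : ℕ
  N = 2 ^ t
  lower′ : minInternals t ⌈ c /2⌉ ≤ i ∸ c
  lower′ = m+n≤o⇒m≤o∸n _ (subst (_≤ i) (+-comm c _) lower)
... | no i′≮N+half =
  k , ⌈n/2⌉≤m⇒n≤2*m half≤k , feasible k≤N lower′ (≤-reflexive (sym N+k≡1+i′))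
  where
  N : ℕ
  N = 2 ^ t
  i′ k : ℕ
  i′ = i ∸ c
  k = suc i′ ∸ N
  N+half≤i′ : N + ⌈ c /2⌉ ≤ i′
  N+half≤i′ = ≮⇒≥ i′≮N+half
  N+k≡1+i′ : N + k ≡ suc i′
  N+k≡1+i′ = m+[n∸m]≡n (≤-trans (m≤m+n N _) (≤-trans N+half≤i′ (n≤1+n i′)))
  half≤k : ⌈ c /2⌉ ≤ k
  half≤k = +-cancelˡ-≤ N _ _ (≤-trans N+half≤i′ (subst (i′ ≤_) (sym N+k≡1+i′) (n≤1+n i′)))
  i′<2N : i′ < N + N
  i′<2N = +-cancelʳ-< c i′ (N + N)
            (subst₂ _<_ (sym (m∸n+n≡m (m+n≤o⇒m≤o c lower))) (cong (_+ c) (2*n≡n+n N)) upper)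
  k≤N : k ≤ N
  k≤N = m≤n+o⇒m∸n≤o (suc i′) N i′<2N
  lower′ : minInternals t k ≤ i′
  lower′ = s≤s⁻¹ (<-≤-trans (minInternals< t k≤N) (≤-reflexive N+k≡1+i′))

feasible⇒reach : ∀ t {i k} → Feasible t i k →
                 ∃[ T ] Reach (suc t) T × internals T ≡ i × anchors T ≡ 2 * k
feasible⇒reach zero {zero}        {zero}        _ = dead , grow start anchor→dead , refl , refl
feasible⇒reach zero {suc zero}    {suc zero}    _ = node anchor anchor , grow start anchor→node , refl , refl
feasible⇒reach zero {suc _}       {zero}        (feasible _ _ (s≤s ()))
feasible⇒reach zero {zero}        {suc zero}    (feasible _ () _)
feasible⇒reach zero {suc (suc _)} {suc zero}    (feasible _ _ (s≤s (s≤s ())))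
feasible⇒reach zero {k = suc (suc _)}           (feasible (s≤s ()) _ _)
feasible⇒reach (suc t) {i} {c} f@(feasible _ lower _) with feasible-parent f
... | k , c≤2k , f′ with feasible⇒reach t f′
... | P , rP , iP , aP with expand P (subst (c ≤_) (sym aP) c≤2k)
... | T , s , expands aT iT = T , grow rP s , trans iT (trans (cong (_+ c) iP) (m∸n+n≡m c≤i)) , aT
  where
  c≤i : c ≤ i
  c≤i = ≤-trans (k≤minInternals (suc t) c) lower

tNonZero⇔feasible : ∀ {t n k} → TNonZero n (2 * suc k) (suc t) ⇔ Feasible t n (suc k)
tNonZero⇔feasible {t} {n} {k} = mk⇔ to from
  where
  to : TNonZero n (2 * suc k) (suc t) → Feasible t n (suc k)
  to (T , (s , r) , act , hT , iT , aT) with trans (sym (height-reach r act)) hT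
  ... | refl with reach⇒feasible r
  ... | k′ , aT′ , f = subst₂ (Feasible t) iT (*-cancelˡ-≡ k′ (suc k) 2 (trans (sym aT′) aT)) f
  from : Feasible t n (suc k) → TNonZero n (2 * suc k) (suc t)
  from f with feasible⇒reach t f
  ... | T , r , iT , aT = T , (suc t , r) , act , height-reach r act , iT , aT
    where
    act : Active T
    act = subst (1 ≤_) (sym aT) (s≤s z≤n)

LastFeasible : ℕ → ℕ → ℕ → Set
LastFeasible t n k = Feasible t n k × ¬ Feasible t n (suc k)

inΛ⇔lastFeasible : ∀ {t n k} → InΛ (suc t) n (suc k) ⇔ LastFeasible t n (suc k)
inΛ⇔lastFeasible {t} {n} {k} = mk⇔
  (λ (_ , tz , ¬tz) → to tNonZero⇔feasible tz , ¬tz ∘ from tNonZero⇔feasible)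
  (λ (f , ¬f) → (1≤n f , s≤s z≤n) , from tNonZero⇔feasible f , ¬f ∘ to tNonZero⇔feasible)
  where
  open Equivalence
  1≤n : Feasible t n (suc k) → 1 ≤ n
  1≤n f = ≤-trans (s≤s z≤n) (≤-trans (k≤minInternals t (suc k)) (Feasible.lower f))

lastFeasible⇒sumB-bounds : ∀ {t d k} → LastFeasible t (suc t + d) (suc k) →
                           suc t + d < 2 ^ suc t × sumB k ≤ d × suc d ≤ sumB (suc k)
lastFeasible⇒sumB-bounds {t} {d} {k} (feasible 1+k≤N lower upper , infeasible) = n<2N , B≤d , d<B
  where
  N n : ℕ
  N = 2 ^ t
  n = suc t + d
  n<2N : n < 2 * N
  n<2N = <-≤-trans upper (subst (N + suc k ≤_) (sym (2*n≡n+n N)) (+-monoʳ-≤ N 1+k≤N))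
  B≤d : sumB k ≤ d
  B≤d = +-cancelˡ-≤ (suc t) _ _ (subst (_≤ n) (minInternals-suc t 1+k≤N) lower)
  d<B : suc d ≤ sumB (suc k)
  d<B with m≤n⇒m<n∨m≡n 1+k≤N
  ... | inj₁ 2+k≤N = ≰⇒> λ B≤d′ → infeasible (feasible 2+k≤N
          (subst (_≤ n) (sym (minInternals-suc t 2+k≤N)) (+-monoʳ-≤ (suc t) B≤d′))
          (≤-trans upper (+-monoʳ-≤ N (n≤1+n (suc k)))))
  ... | inj₂ 1+k≡N = begin
    suc d          ≤⟨ s≤s (m≤n+m d t) ⟩
    n              ≤⟨ s≤s⁻¹ (subst (n <_) (sym (sumB-2^ t)) n<2N) ⟩
    sumB N         ≡⟨ cong sumB (sym 1+k≡N) ⟩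
    sumB (suc k)   ∎
    where open ≤-Reasoning

sumB-bounds⇒lastFeasible : ∀ {t d k} → suc t + d < 2 ^ suc t → sumB k ≤ d × suc d ≤ sumB (suc k) →
                           LastFeasible t (suc t + d) (suc k)
sumB-bounds⇒lastFeasible {t} {d} {k} n<2N (B≤d , d<B) =
  feasible 1+k≤N (subst (_≤ n) (sym (minInternals-suc t 1+k≤N)) (+-monoʳ-≤ (suc t) B≤d)) upper ,
  λ (feasible 2+k≤N lower _) →
    ≤⇒≯ (+-cancelˡ-≤ (suc t) _ _ (subst (_≤ n) (minInternals-suc t 2+k≤N) lower)) d<B
  where
  N n : ℕ
  N = 2 ^ t
  n = suc t + d
  1+k≤N : suc k ≤ N
  1+k≤N = ≮⇒≥ λ N<1+k → <⇒≱ n<2N (begin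
    2 * N              ≡⟨ sym (sumB-2^ t) ⟩
    suc (sumB N)       ≤⟨ s≤s (≤-trans (sumB-mono (s≤s⁻¹ N<1+k)) B≤d) ⟩
    suc d              ≤⟨ s≤s (m≤n+m d t) ⟩
    n                  ∎)
    where open ≤-Reasoning
  upper : n < N + suc k
  upper with m≤n⇒m<n∨m≡n 1+k≤N
  ... | inj₁ 2+k≤N = begin-strict
    n                               <⟨ +-monoʳ-< (suc t) d<B ⟩
    suc t + sumB (suc k)            ≡⟨ sym (minInternals-suc t 2+k≤N) ⟩
    minInternals t (suc (suc k))    ≤⟨ s≤s⁻¹ (subst (_<_ _) (+-suc N (suc k)) (minInternals< t 2+k≤N)) ⟩
    N + suc k                       ∎
    where open ≤-Reasoning
  ... | inj₂ 1+k≡N = subst (n <_) (trans (2*n≡n+n N) (cong (N +_) (sym 1+k≡N))) n<2N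

<⇔≤∸1 : ∀ {m n} → 0 < n → m < n ⇔ m ≤ n ∸ 1
<⇔≤∸1 {n = suc n} _ = mk⇔ s≤s⁻¹ s≤s

lastFeasible⇔aHat : ∀ t n k → LastFeasible t n (suc k) ⇔
                    (suc t ≤ n × n ≤ 2 ^ suc t ∸ 1 × IsAHat (suc (n ∸ suc t)) (suc k))
lastFeasible⇔aHat t n k = mk⇔ to from
  where
  <2^h⇔≤2^h∸1 : ∀ {m} → m < 2 ^ suc t ⇔ m ≤ 2 ^ suc t ∸ 1
  <2^h⇔≤2^h∸1 = <⇔≤∸1 (m^n>0 2 (suc t))
  to : LastFeasible t n (suc k) → suc t ≤ n × n ≤ 2 ^ suc t ∸ 1 × IsAHat (suc (n ∸ suc t)) (suc k)
  to last@(feasible 1+k≤N lower _ , _)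
    with m≤n⇒∃[o]m+o≡n (m+n≤o⇒m≤o (suc t) (subst (_≤ n) (minInternals-suc t 1+k≤N) lower))
  ... | d , refl rewrite m+n∸m≡n (suc t) d with lastFeasible⇒sumB-bounds last
  ... | n<2N , bounds =
    m≤m+n (suc t) d , Equivalence.to <2^h⇔≤2^h∸1 n<2N , Equivalence.from isAHat⇔ bounds
  from : suc t ≤ n × n ≤ 2 ^ suc t ∸ 1 × IsAHat (suc (n ∸ suc t)) (suc k) → LastFeasible t n (suc k)
  from (h≤n , n≤2N∸1 , a) with m≤n⇒∃[o]m+o≡n h≤n
  ... | d , refl rewrite m+n∸m≡n (suc t) d =
    sumB-bounds⇒lastFeasible (Equivalence.from <2^h⇔≤2^h∸1 n≤2N∸1) (Equivalence.to isAHat⇔ a)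

proposition4p3 : (h : ℕ) → 1 ≤ h → (n k : ℕ) →
    InΛ h n k ⇔ (h ≤ n × n ≤ 2 ^ h ∸ 1 × IsAHat (suc (n ∸ h)) k)
proposition4p3 zero    ()
proposition4p3 (suc t) _  n zero    = mk⇔ (λ { ((_ , ()) , _) }) (λ { (_ , _ , (() , _) , _) })
proposition4p3 (suc t) _  n (suc k) = ⇔-trans inΛ⇔lastFeasible (lastFeasible⇔aHat t n k)
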